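{- Let $K$ be an idempotent, linearly ordered, archimedian, cancellative commutative semiring. Let $u,q\in K$, $S=u(qX)^*$, let $r\geq1$ and $u_1,\ldots,u_r,q_1,\ldots,q_r\in K$, $T_i=u_i(q_iX)^*$ for $1\leq i\leq r$, and $T=\bigoplus_{1\leq i\leq r}T_i$. Then $T=S$ if and only if $T_i\leq S$ for all $1\leq i\leq r$ and $T_j=S$ for some $1\leq j\leq r$.
   Context: Idempotent: $u\oplus u=u$; linearly ordered: $u\leq v\iff u\oplus v=v$ is a linear order; archimedian: $u\lambda^k\geq v\mu^k$ for all $k\geq0$ implies $v=\mathbb{0}$ or $\lambda\geq\mu$; cancellative: $uv=u'v$ implies $v=\mathbb{0}$ or $u=u'$. For $a\in K$, $(aX)^*=\bigoplus_{k\geq0}a^kX^k$, so $u(qX)^*$ is the series in $K[[X]]$ with $k$-th coefficient $uq^k$. Series are added and compared coefficientwise. -}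

module Defs where

open import Level using (_⊔_)
open import Algebra.Bundles using (CommutativeSemiring)
open import Data.Nat using (ℕ; zero; suc)
open import Data.Fin using (Fin; zero; suc)
open import Data.Sum using (_⊎_)

module Semiring-Defs {c ℓ} (K : CommutativeSemiring c ℓ) where
  open CommutativeSemiring K using (Carrier; _≈_; _+_; _*_; 0#; 1#)

  _^_ : Carrier → ℕ → Carrier
  a ^ zero  = 1#
  a ^ suc k = a * (a ^ k)

  _≤_ : Carrier → Carrier → Set ℓ
  u ≤ v = (u + v) ≈ v

  Idempotent : Set (c ⊔ ℓ)
  Idempotent = ∀ u → (u + u) ≈ u

  LinearlyOrdered : Set (c ⊔ ℓ)
  LinearlyOrdered = ∀ u v → (u ≤ v) ⊎ (v ≤ u)

  Archimedean : Set (c ⊔ ℓ)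
  Archimedean = ∀ u v λ' μ → (∀ k → (v * (μ ^ k)) ≤ (u * (λ' ^ k)))
                → (v ≈ 0#) ⊎ (μ ≤ λ')

  Cancellative : Set (c ⊔ ℓ)
  Cancellative = ∀ u u' v → (u * v) ≈ (u' * v) → (v ≈ 0#) ⊎ (u ≈ u')

  -- formal power series K[[X]] as coefficient sequences
  Series : Set c
  Series = ℕ → Carrier

  -- u (qX)^* : k-th coefficient u q^k
  geom : Carrier → Carrier → Series
  geom u q k = u * (q ^ k)

  _≈ₛ_ : Series → Series → Set ℓ
  S ≈ₛ T = ∀ k → S k ≈ T k

  _≤ₛ_ : Series → Series → Set ℓ
  S ≤ₛ T = ∀ k → S k ≤ T k

  ⨁ : ∀ r → (Fin r → Carrier) → Carrier
  ⨁ zero    f = 0#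
  ⨁ (suc r) f = f zero + ⨁ r (λ i → f (suc i))

  ⨁ₛ : ∀ r → (Fin r → Series) → Series
  ⨁ₛ r T k = ⨁ r (λ i → T i k)

module Submission where

-- The order u ≤ v ⇔ u + v ≈ v makes K a partial order in which u + v is
-- the least upper bound of u and v; if K is linearly ordered, a nonempty
-- finite sum therefore equals its largest summand.  Hence ⊕ᵢ Tᵢ = S is
-- equivalent to "every Tᵢ ≤ S, and at every coefficient k some Tᵢ
-- attains S k", which already gives the backward direction.
--
-- For the forward direction write Tⱼ = a (bX)* and S = u (qX)*.  A
-- geometric series is determined by its first two coefficients a and ab
-- (cancellativity, `geom-ext`), so it suffices to find j with a = u and
-- ab = uq.  Take j attaining S at coefficient 1, so ab = uq.  Since
-- Tⱼ ≤ S, the archimedean property gives a = 0 or b ≤ q; in the latter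
-- case aq ≤ uq = ab ≤ aq, and cancelling q yields a = u (`slope-attained`).
-- The remaining degenerate case uq = 0 is handled by taking j attaining S
-- at coefficient 0 instead: then a = u and ab ≤ uq = 0 (`degenerate-attained`).

open import Defs
open import Algebra.Bundles using (CommutativeSemiring)
open import Data.Nat using (ℕ; zero; suc; s≤s; z≤n) renaming (_≤_ to _≤ℕ_)
open import Data.Fin using (Fin; zero; suc)
open import Data.Product using (_×_; ∃; _,_)
open import Data.Sum using (_⊎_; inj₁; inj₂)
open import Function.Bundles using (_⇔_; mk⇔)

module GeometricSums {c ℓ} (K : CommutativeSemiring c ℓ) where
  open CommutativeSemiring K hiding (zero)
  open Semiring-Defs K
  open import Relation.Binary.Reasoning.Setoid setoid

  ≤-antisym : ∀ {a b} → a ≤ b → b ≤ a → a ≈ b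
  ≤-antisym {a} {b} a≤b b≤a = begin
    a     ≈⟨ b≤a ⟨
    b + a ≈⟨ +-comm b a ⟩
    a + b ≈⟨ a≤b ⟩
    b     ∎

  ≤-trans : ∀ {a b d} → a ≤ b → b ≤ d → a ≤ d
  ≤-trans {a} {b} {d} a≤b b≤d = begin
    a + d       ≈⟨ +-congˡ b≤d ⟨
    a + (b + d) ≈⟨ +-assoc a b d ⟨
    (a + b) + d ≈⟨ +-congʳ a≤b ⟩
    b + d       ≈⟨ b≤d ⟩
    d           ∎

  ≤-respʳ : ∀ {a b d} → b ≈ d → a ≤ b → a ≤ d
  ≤-respʳ b≈d a≤b = trans (+-congˡ (sym b≈d)) (trans a≤b b≈d)

  ≤-respˡ : ∀ {a b d} → a ≈ d → a ≤ b → d ≤ b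
  ≤-respˡ a≈d a≤b = trans (+-congʳ (sym a≈d)) a≤b

  *-monoʳ-≤ : ∀ {a b} d → a ≤ b → (a * d) ≤ (b * d)
  *-monoʳ-≤ {a} {b} d a≤b = trans (sym (distribʳ d a b)) (*-congʳ a≤b)

  *-monoˡ-≤ : ∀ {a b} d → a ≤ b → (d * a) ≤ (d * b)
  *-monoˡ-≤ {a} {b} d a≤b =
    ≤-respˡ (*-comm a d) (≤-respʳ (*-comm b d) (*-monoʳ-≤ d a≤b))

  ≤0⇒≈0 : ∀ {a} → a ≤ 0# → a ≈ 0#
  ≤0⇒≈0 {a} a≤0 = trans (sym (+-identityʳ a)) a≤0

  module _ (idem : Idempotent) where

    x≤x+y : ∀ x y → x ≤ (x + y)
    x≤x+y x y = trans (sym (+-assoc x x y)) (+-congʳ (idem x))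

    y≤x+y : ∀ x y → y ≤ (x + y)
    y≤x+y x y = ≤-respʳ (+-comm y x) (x≤x+y y x)

    summand≤⨁ : ∀ n (f : Fin n → Carrier) i → f i ≤ ⨁ n f
    summand≤⨁ (suc n) f zero    = x≤x+y _ _
    summand≤⨁ (suc n) f (suc i) =
      ≤-trans (summand≤⨁ n (λ i → f (suc i)) i) (y≤x+y _ _)

  ⨁-least : ∀ n (f : Fin n → Carrier) s → (∀ i → f i ≤ s) → ⨁ n f ≤ s
  ⨁-least zero    f s f≤s = +-identityˡ s
  ⨁-least (suc n) f s f≤s = begin
    (f zero + ⨁ n f′) + s ≈⟨ +-assoc _ _ _ ⟩
    f zero + (⨁ n f′ + s) ≈⟨ +-congˡ (⨁-least n f′ s (λ i → f≤s (suc i))) ⟩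
    f zero + s            ≈⟨ f≤s zero ⟩
    s                     ∎
    where
    f′ : Fin n → Carrier
    f′ i = f (suc i)

  ⨁-attained : LinearlyOrdered →
               ∀ n (f : Fin (suc n) → Carrier) → ∃ λ j → ⨁ (suc n) f ≈ f j
  ⨁-attained lin zero    f = zero , +-identityʳ (f zero)
  ⨁-attained lin (suc n) f with ⨁-attained lin n (λ i → f (suc i))
  ... | j , rest≈fj with lin (f zero) (f (suc j))
  ... | inj₁ f0≤fj = suc j , trans (+-congˡ rest≈fj) f0≤fj
  ... | inj₂ fj≤f0 = zero  , trans (+-congˡ rest≈fj) (trans (+-comm _ _) fj≤f0)

  ^-cong : ∀ {a b} k → a ≈ b → (a ^ k) ≈ (b ^ k)
  ^-cong zero    a≈b = refl
  ^-cong (suc k) a≈b = *-cong a≈b (^-cong k a≈b)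

  geom-0 : ∀ a b → geom a b 0 ≈ a
  geom-0 a b = *-identityʳ a

  geom-1 : ∀ a b → geom a b 1 ≈ a * b
  geom-1 a b = *-congˡ (*-identityʳ b)

  geom-ext : Cancellative → ∀ {a b u q} → a ≈ u → a * b ≈ u * q →
             geom a b ≈ₛ geom u q
  geom-ext canc {a} {b} {u} {q} a≈u ab≈uq k
    with canc b q a (trans (*-comm b a) (trans ab≈uq (trans (*-congʳ (sym a≈u)) (*-comm a q))))
  ... | inj₂ b≈q = *-cong a≈u (^-cong k b≈q)
  ... | inj₁ a≈0 = begin
    a * (b ^ k)  ≈⟨ *-congʳ a≈0 ⟩
    0# * (b ^ k) ≈⟨ zeroˡ _ ⟩
    0#           ≈⟨ zeroˡ _ ⟨
    0# * (q ^ k) ≈⟨ *-congʳ (trans (sym a≈u) a≈0) ⟨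
    u * (q ^ k)  ∎

  -- A series below u (qX)* with the same constant term equals it when
  -- uq = 0: its second coefficient is squeezed to 0 as well.
  degenerate-attained : Cancellative → ∀ {a b u q} →
    geom a b ≤ₛ geom u q → a ≈ u → u * q ≈ 0# → geom a b ≈ₛ geom u q
  degenerate-attained canc {a} {b} {u} {q} T≤S a≈u uq≈0 =
    geom-ext canc a≈u (trans ab≈0 (sym uq≈0))
    where
    ab≈0 : a * b ≈ 0#
    ab≈0 = ≤0⇒≈0 (≤-respˡ (geom-1 a b) (≤-respʳ (trans (geom-1 u q) uq≈0) (T≤S 1)))

  slope-attained : Archimedean → Cancellative → ∀ {a b u q} →
    geom a b ≤ₛ geom u q → a * b ≈ u * q → (u * q ≈ 0#) ⊎ (geom a b ≈ₛ geom u q)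
  slope-attained arch canc {a} {b} {u} {q} T≤S ab≈uq with arch u a q b T≤S
  ... | inj₁ a≈0 = inj₁ (begin
    u * q  ≈⟨ ab≈uq ⟨
    a * b  ≈⟨ *-congʳ a≈0 ⟩
    0# * b ≈⟨ zeroˡ b ⟩
    0#     ∎)
  ... | inj₂ b≤q with canc a u q aq≈uq
    where
    a≤u : a ≤ u
    a≤u = ≤-respˡ (geom-0 a b) (≤-respʳ (geom-0 u q) (T≤S 0))
    uq≤aq : (u * q) ≤ (a * q)
    uq≤aq = ≤-respˡ ab≈uq (*-monoˡ-≤ a b≤q)
    aq≈uq : a * q ≈ u * q
    aq≈uq = ≤-antisym (*-monoʳ-≤ q a≤u) uq≤aq
  ... | inj₁ q≈0 = inj₁ (trans (*-congˡ q≈0) (zeroʳ u))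
  ... | inj₂ a≈u = inj₂ (geom-ext canc a≈u ab≈uq)

lemma7 : ∀ {c ℓ} (K : CommutativeSemiring c ℓ) →
    let open CommutativeSemiring K using (Carrier)
        open Semiring-Defs K
    in Idempotent → LinearlyOrdered → Archimedean → Cancellative →
       (u q : Carrier) (r : ℕ) → 1 ≤ℕ r → (us qs : Fin r → Carrier) →
       (⨁ₛ r (λ i → geom (us i) (qs i)) ≈ₛ geom u q)
       ⇔ ((∀ i → geom (us i) (qs i) ≤ₛ geom u q)
          × ∃ (λ j → geom (us j) (qs j) ≈ₛ geom u q))
lemma7 K idem lin arch canc u q (suc n) (s≤s z≤n) us qs = mk⇔ forward backward
  where
  open CommutativeSemiring K using (_≈_; sym; trans)
  open GeometricSums K
  open Semiring-Defs K
  T : Fin (suc n) → Series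
  T i = geom (us i) (qs i)
  S : Series
  S = geom u q

  backward : (∀ i → T i ≤ₛ S) × ∃ (λ j → T j ≈ₛ S) → ⨁ₛ (suc n) T ≈ₛ S
  backward (T≤S , j , Tj≈S) k = ≤-antisym
    (⨁-least (suc n) (λ i → T i k) (S k) (λ i → T≤S i k))
    (≤-respˡ (Tj≈S k) (summand≤⨁ idem (suc n) (λ i → T i k) j))

  forward : ⨁ₛ (suc n) T ≈ₛ S → (∀ i → T i ≤ₛ S) × ∃ (λ j → T j ≈ₛ S)
  forward ⨁T≈S = T≤S , dominant
    where
    T≤S : ∀ i → T i ≤ₛ S
    T≤S i k = ≤-respʳ (⨁T≈S k) (summand≤⨁ idem (suc n) (λ i → T i k) i)

    attains : ∀ k → ∃ λ j → T j k ≈ S k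
    attains k with ⨁-attained lin n (λ i → T i k)
    ... | j , ⨁≈Tj = j , trans (sym ⨁≈Tj) (⨁T≈S k)

    dominant : ∃ (λ j → T j ≈ₛ S)
    dominant with attains 1
    ... | j₁ , Tj₁≈S
      with slope-attained arch canc (T≤S j₁)
             (trans (sym (geom-1 (us j₁) (qs j₁))) (trans Tj₁≈S (geom-1 u q)))
    ... | inj₂ Tj₁≈ₛS = j₁ , Tj₁≈ₛS
    ... | inj₁ uq≈0 with attains 0
    ... | j₀ , Tj₀≈S = j₀ , degenerate-attained canc (T≤S j₀)
            (trans (sym (geom-0 (us j₀) (qs j₀))) (trans Tj₀≈S (geom-0 u q))) uq≈0
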